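{- Let $(M,\in_1,\in_2)\models ZFC(\in_1)\cup ZFC(\in_2)$ and let $\alpha,y\in M$ satisfy $\phi(\alpha,y)$. Then $\mathrm{On}_1(\alpha)$ holds if and only if $\mathrm{On}_2(y)$ holds. Moreover, if $\alpha$ is an $\in_1$-limit ordinal, i.e. $\forall u\in_1\alpha\,\exists v\in_1\alpha\,(u\in_1 v)$, then $y$ is an $\in_2$-limit ordinal, i.e. $\forall u\in_2 y\,\exists v\in_2 y\,(u\in_2 v)$, and vice versa.
   Context: $ZFC(\in_1)$ denotes the first-order ZFC axioms with $\in_1$ as membership relation, where formulas in the schemas (Separation, Replacement) may contain both $\in_1$ and $\in_2$; $ZFC(\in_2)$ is symmetric. For $i=1,2$, $\mathrm{tr}_i(x)$ is the formula $\forall t\in_i x\,\forall w\in_i t\,(w\in_i x)$, and $\mathrm{On}_i(x)$ is the formula saying that $x$ is an ordinal in the sense of $\in_i$, i.e. $\mathrm{tr}_i(x)$ and $\forall s\in_i x\,\mathrm{tr}_i(s)$. $\mathrm{TC}_i(x)$ denotes the unique $u$ such that $\mathrm{tr}_i(u)$, $\forall v\in_i x\,(v\in_i u)$, and for every $v$ with $\mathrm{tr}_i(v)\wedge\forall w\in_i x\,(w\in_i v)$ we have $\forall w\in_i u\,(w\in_i v)$ (the $\in_i$-transitive closure of $x$); in $\mathrm{TC}_i(\{x\})$, $\{x\}$ is the singleton in the sense of $\in_i$. $\psi(x,y,f)$ is the conjunction of: (i) in the sense of $\in_1$, $f$ is a function with domain $\mathrm{TC}_1(\{x\})$; (ii)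 $\forall t\in_1\mathrm{TC}_1(x)\,(f(t)\in_2\mathrm{TC}_2(y))$; (iii) $\forall t\in_2\mathrm{TC}_2(y)\,\exists w\in_1\mathrm{TC}_1(x)\,(t=f(w))$; (iv) $\forall t\in_1\mathrm{TC}_1(x)\,\forall w\in_1\mathrm{TC}_1(\{x\})\,(t\in_1 w\leftrightarrow f(t)\in_2 f(w))$; (v) $f(x)=y$. Function application $f(t)$ is in the sense of $\in_1$. $\phi(x,y)$ is the formula $\exists f\,\psi(x,y,f)$. -}

module Defs where

open import Level using (0ℓ)
open import Data.Nat using (ℕ; zero; suc)
open import Data.Product using (Σ; _×_; _,_)
open import Data.Sum using (_⊎_)
open import Data.Empty using (⊥)
open import Relation.Nullary using (¬_)
open import Relation.Binary.PropositionalEquality using (_≡_; _≢_)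

_iff_ : Set → Set → Set
A iff B = (A → B) × (B → A)

infix 2 _iff_

-- First-order formulas in the language {∈₁, ∈₂, =}, de Bruijn variables

data Formula : Set where
  mem₁ mem₂ eq : ℕ → ℕ → Formula
  falsum       : Formula
  _⇒_ _∧_ _∨_  : Formula → Formula → Formula
  neg          : Formula → Formula
  all ex       : Formula → Formula

module _ {M : Set} where

  _∷ₑ_ : M → (ℕ → M) → (ℕ → M)
  (a ∷ₑ ρ) zero    = a
  (a ∷ₑ ρ) (suc n) = ρ n

  -- Tarski satisfaction in (M, E₁, E₂); classical when Excluded Middle is assumed
  Sat : (E₁ E₂ : M → M → Set) → Formula → (ℕ → M) → Set
  Sat E₁ E₂ (mem₁ i j) ρ = E₁ (ρ i) (ρ j)
  Sat E₁ E₂ (mem₂ i j) ρ = E₂ (ρ i) (ρ j)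
  Sat E₁ E₂ (eq i j)   ρ = ρ i ≡ ρ j
  Sat E₁ E₂ falsum     ρ = ⊥
  Sat E₁ E₂ (φ ⇒ ψ)   ρ = Sat E₁ E₂ φ ρ → Sat E₁ E₂ ψ ρ
  Sat E₁ E₂ (φ ∧ ψ)   ρ = Sat E₁ E₂ φ ρ × Sat E₁ E₂ ψ ρ
  Sat E₁ E₂ (φ ∨ ψ)   ρ = Sat E₁ E₂ φ ρ ⊎ Sat E₁ E₂ ψ ρ
  Sat E₁ E₂ (neg φ)    ρ = ¬ Sat E₁ E₂ φ ρ
  Sat E₁ E₂ (all φ)    ρ = (a : M) → Sat E₁ E₂ φ (a ∷ₑ ρ)
  Sat E₁ E₂ (ex φ)     ρ = Σ M λ a → Sat E₁ E₂ φ (a ∷ₑ ρ)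

  -- ZFC with membership _∈_, schemas ranging over formulas in ∈₁ and ∈₂

  record ZFC (E₁ E₂ : M → M → Set) (_∈_ : M → M → Set) : Set₁ where
    field
      extensionality : ∀ a b → (∀ x → (x ∈ a) iff (x ∈ b)) → a ≡ b
      foundation     : ∀ a → Σ M (λ x → x ∈ a) →
                       Σ M λ x → x ∈ a × (∀ z → z ∈ x → ¬ (z ∈ a))
      pairing        : ∀ a b → Σ M λ c → a ∈ c × b ∈ c
      union          : ∀ a → Σ M λ u → ∀ x → x ∈ a → ∀ z → z ∈ x → z ∈ u
      powerset       : ∀ a → Σ M λ p → ∀ z → (∀ w → w ∈ z → w ∈ a) → z ∈ p
      infinity       : Σ M λ I → (Σ M λ e → e ∈ I × (∀ z → ¬ (z ∈ e)))
                         × (∀ x → x ∈ I → Σ M λ s → s ∈ I × (∀ z → (z ∈ s) iff (z ∈ x ⊎ z ≡ x)))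
      -- Separation: x is variable 0 of φ; parameters come from ρ
      separation     : ∀ (φ : Formula) (ρ : ℕ → M) (z : M) →
                       Σ M λ y → ∀ x → (x ∈ y) iff (x ∈ z × Sat E₁ E₂ φ (x ∷ₑ ρ))
      -- Replacement: in φ, variable 0 is the output y, variable 1 the input x
      replacement    : ∀ (φ : Formula) (ρ : ℕ → M) (A : M) →
                       (∀ x → x ∈ A → Σ M λ y → Sat E₁ E₂ φ (y ∷ₑ (x ∷ₑ ρ))
                            × (∀ y′ → Sat E₁ E₂ φ (y′ ∷ₑ (x ∷ₑ ρ)) → y′ ≡ y)) →
                       Σ M λ B → ∀ x → x ∈ A → Σ M λ y → y ∈ B × Sat E₁ E₂ φ (y ∷ₑ (x ∷ₑ ρ))
      choice         : ∀ F → (∀ x → x ∈ F → Σ M λ z → z ∈ x) →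
                       (∀ x y → x ∈ F → y ∈ F → x ≢ y → ∀ z → z ∈ x → ¬ (z ∈ y)) →
                       Σ M λ S → ∀ x → x ∈ F → Σ M λ z → z ∈ x × z ∈ S
                         × (∀ w → w ∈ x → w ∈ S → w ≡ z)

  module Notions (_∈_ : M → M → Set) where

    tr : M → Set
    tr x = ∀ t → t ∈ x → ∀ w → w ∈ t → w ∈ x

    On : M → Set
    On x = tr x × (∀ s → s ∈ x → tr s)

    Lim : M → Set
    Lim x = ∀ u → u ∈ x → Σ M λ v → v ∈ x × u ∈ v

    IsTC : M → M → Set
    IsTC x u = tr u × (∀ v → v ∈ x → v ∈ u)
               × (∀ v → tr v → (∀ w → w ∈ x → w ∈ v) → ∀ w → w ∈ u → w ∈ v)

    IsSingleton : M → M → Set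
    IsSingleton x s = ∀ z → (z ∈ s) iff (z ≡ x)

    IsUPair : M → M → M → Set
    IsUPair a b c = ∀ z → (z ∈ c) iff (z ≡ a ⊎ z ≡ b)

    IsPair : M → M → M → Set
    IsPair a b p = ∀ z → (z ∈ p) iff (IsSingleton a z ⊎ IsUPair a b z)

    App : M → M → M → Set
    App f t z = Σ M λ p → IsPair t z p × p ∈ f

    IsFunctionOn : M → M → Set
    IsFunctionOn f D =
        (∀ p → p ∈ f → Σ M λ a → Σ M λ b → IsPair a b p)
      × (∀ a b b′ → App f a b → App f a b′ → b ≡ b′)
      × (∀ a → (a ∈ D) iff (Σ M λ b → App f a b))

  module Iso (E₁ E₂ : M → M → Set) where
    open Notions E₁ renaming (IsTC to IsTC₁; IsSingleton to IsSingleton₁;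
                              App to App₁; IsFunctionOn to IsFunctionOn₁)
    open Notions E₂ using () renaming (IsTC to IsTC₂)

    ψ : M → M → M → Set
    ψ x y f = Σ M λ sx → Σ M λ D → Σ M λ Tx → Σ M λ Ty →
        IsSingleton₁ x sx × IsTC₁ sx D × IsTC₁ x Tx × IsTC₂ y Ty
      × IsFunctionOn₁ f D
      × (∀ t → E₁ t Tx → ∀ z → App₁ f t z → E₂ z Ty)
      × (∀ t → E₂ t Ty → Σ M λ w → E₁ w Tx × App₁ f w t)
      × (∀ t w a b → E₁ t Tx → E₁ w D → App₁ f t a → App₁ f w b →
            (E₁ t w) iff (E₂ a b))
      × App₁ f x y

    ϕ : M → M → Set
    ϕ x y = Σ M λ f → ψ x y f

-- ψ makes f an ∈-isomorphism between TC₁({α}) and TC₂({y}) sending α to y. Such an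
-- isomorphism is a back-and-forth correspondence between the ∈₁-predecessors of α and
-- the ∈₂-predecessors of y, and transitivity, transitivity of elements and the limit
-- property are statements about predecessors only, so they transfer; the converse
-- directions follow by inverting the correspondence.
module Submission where

open import Defs
open import Level using (0ℓ)
open import Data.Product using (Σ; _×_; _,_; proj₁; proj₂; swap; map)
open import Data.Sum as Sum using (_⊎_; inj₁; inj₂)
open import Function using (flip)
open import Axiom.ExcludedMiddle using (ExcludedMiddle)
open import Relation.Binary.PropositionalEquality using (_≡_; refl)

module _ {M : Set} where

  -- The root pair (α, y) is added separately: clause (iv) of ψ only covers pairs whose
  -- left member lies in TC₁(α), which α itself need not do.
  WithRoot : (M → M → Set) → M → M → M → M → Set
  WithRoot R α y t a = R t a ⊎ (t ≡ α × a ≡ y)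

  record MembershipIso (E₁ E₂ : M → M → Set) (α y : M) : Set₁ where
    field
      _≈_   : M → M → Set
      forth : ∀ {t a} → WithRoot _≈_ α y t a → ∀ w → E₁ w t → Σ M λ b → w ≈ b × E₂ b a
      back  : ∀ {t a} → WithRoot _≈_ α y t a → ∀ b → E₂ b a → Σ M λ w → w ≈ b × E₁ w t
      ∈-iff : ∀ {t a w b} → t ≈ a → WithRoot _≈_ α y w b → E₁ t w iff E₂ a b

    root : WithRoot _≈_ α y α y
    root = inj₂ (refl , refl)

  WithRoot-flip : ∀ {R α y t a} → WithRoot R α y t a → WithRoot (flip R) y α a t
  WithRoot-flip = Sum.map₂ swap

  MembershipIso-sym : ∀ {E₁ E₂ α y} → MembershipIso E₁ E₂ α y → MembershipIso E₂ E₁ y α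
  MembershipIso-sym {α = α} {y} iso = record
    { _≈_   = flip _≈_
    ; forth = λ r → back (unflip r)
    ; back  = λ r → forth (unflip r)
    ; ∈-iff = λ r s → swap (∈-iff r (unflip s))
    }
    where
    open MembershipIso iso
    unflip : ∀ {t a} → WithRoot (flip _≈_) y α a t → WithRoot _≈_ α y t a
    unflip = WithRoot-flip {R = flip _≈_}

  module Transfer {E₁ E₂ : M → M → Set} {α y : M} (iso : MembershipIso E₁ E₂ α y) where
    open MembershipIso iso
    open Notions E₁ using () renaming (tr to tr₁; On to On₁; Lim to Lim₁)
    open Notions E₂ using () renaming (tr to tr₂; On to On₂; Lim to Lim₂)

    tr-transfer : ∀ {t a} → WithRoot _≈_ α y t a → tr₁ t → tr₂ a
    tr-transfer t≈a tr-t b b∈a c c∈b with back t≈a b b∈a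
    ... | w , w≈b , w∈t with back (inj₁ w≈b) c c∈b
    ... | v , v≈c , v∈w = proj₁ (∈-iff v≈c t≈a) (tr-t w w∈t v v∈w)

    On-transfer : On₁ α → On₂ y
    On-transfer (tr-α , tr-elements) = tr-transfer root tr-α , tr-elements₂
      where
      tr-elements₂ : ∀ u → E₂ u y → tr₂ u
      tr-elements₂ u u∈y with back root u u∈y
      ... | t , t≈u , t∈α = tr-transfer (inj₁ t≈u) (tr-elements t t∈α)

    Lim-transfer : Lim₁ α → Lim₂ y
    Lim-transfer lim u u∈y with back root u u∈y
    ... | t , t≈u , t∈α with lim t t∈α
    ... | v , v∈α , t∈v with forth root v v∈α
    ... | b , v≈b , b∈y = b , b∈y , proj₁ (∈-iff t≈u (inj₁ v≈b)) t∈v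

  module _ {E₁ E₂ : M → M → Set} where
    open Notions E₁ using () renaming (App to App₁)

    ϕ⇒MembershipIso : ∀ {α y} → Iso.ϕ E₁ E₂ α y → MembershipIso E₁ E₂ α y
    ϕ⇒MembershipIso {α} {y} (f , sα , D , Tα , Ty , sα-sing , (tr-D , sα⊆D , _)
                            , (tr-Tα , α⊆Tα , Tα-least) , (tr-Ty , y⊆Ty , _)
                            , (_ , _ , dom) , into , onto , ∈-preserved , fα≡y) = record
      { _≈_   = _≈_
      ; forth = forth
      ; back  = back
      ; ∈-iff = ∈-iff
      }
      where
      _≈_ : M → M → Set
      t ≈ a = E₁ t Tα × App₁ f t a

      α∈D : E₁ α D
      α∈D = sα⊆D α (proj₂ (sα-sing α) refl)

      Tα⊆D : ∀ w → E₁ w Tα → E₁ w D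
      Tα⊆D = Tα-least D tr-D (λ w w∈α → tr-D α α∈D w w∈α)

      related-facts : ∀ {t a} → WithRoot _≈_ α y t a →
             E₁ t D × App₁ f t a × (∀ w → E₁ w t → E₁ w Tα) × (∀ b → E₂ b a → E₂ b Ty)
      related-facts (inj₁ (t∈Tα , ft≡a)) =
        Tα⊆D _ t∈Tα , ft≡a , tr-Tα _ t∈Tα , tr-Ty _ (into _ t∈Tα _ ft≡a)
      related-facts (inj₂ (refl , refl)) = α∈D , fα≡y , α⊆Tα , y⊆Ty

      forth : ∀ {t a} → WithRoot _≈_ α y t a → ∀ w → E₁ w t → Σ M λ b → w ≈ b × E₂ b a
      forth t≈⁺a w w∈t with related-facts t≈⁺a
      ... | t∈D , ft≡a , t⊆Tα , _ with proj₁ (dom w) (Tα⊆D w (t⊆Tα w w∈t))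
      ... | b , fw≡b =
        b , (t⊆Tα w w∈t , fw≡b) , proj₁ (∈-preserved _ _ _ _ (t⊆Tα w w∈t) t∈D fw≡b ft≡a) w∈t

      ∈-iff : ∀ {t a w b} → t ≈ a → WithRoot _≈_ α y w b → E₁ t w iff E₂ a b
      ∈-iff (t∈Tα , ft≡a) w≈⁺b with related-facts w≈⁺b
      ... | w∈D , fw≡b , _ , _ = ∈-preserved _ _ _ _ t∈Tα w∈D ft≡a fw≡b

      back : ∀ {t a} → WithRoot _≈_ α y t a → ∀ b → E₂ b a → Σ M λ w → w ≈ b × E₁ w t
      back t≈⁺a b b∈a with related-facts t≈⁺a
      ... | t∈D , ft≡a , _ , a⊆Ty with onto b (a⊆Ty b b∈a)
      ... | w , w∈Tα , fw≡b =
        w , (w∈Tα , fw≡b) , proj₂ (∈-preserved _ _ _ _ w∈Tα t∈D fw≡b ft≡a) b∈a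

lemma5 : ExcludedMiddle 0ℓ →
    (M : Set) (E₁ E₂ : M → M → Set) →
    ZFC E₁ E₂ E₁ → ZFC E₁ E₂ E₂ →
    (α y : M) → Iso.ϕ E₁ E₂ α y →
    ((Notions.On E₁ α) iff (Notions.On E₂ y))
    × ((Notions.On E₁ α × Notions.Lim E₁ α) → (Notions.On E₂ y × Notions.Lim E₂ y))
    × ((Notions.On E₂ y × Notions.Lim E₂ y) → (Notions.On E₁ α × Notions.Lim E₁ α))
lemma5 _ M E₁ E₂ _ _ α y ϕ-αy =
    (To.On-transfer , From.On-transfer)
  , map To.On-transfer To.Lim-transfer
  , map From.On-transfer From.Lim-transfer
  where
  iso : MembershipIso E₁ E₂ α y
  iso = ϕ⇒MembershipIso ϕ-αy
  module To   = Transfer iso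
  module From = Transfer (MembershipIso-sym iso)
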